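{- Let $t>1$ be odd. The number of distinct distributions for $t$ equals the number of ways of writing $\frac{t-1}{2}=T_0+T_1+T_2+T_3$ with $T_0\le T_1\le T_2\le T_3$ triangular numbers (i.e. each of the form $\frac{m(m+1)}{2}$ with $m\ge0$ an integer, so $0$ is allowed).
   Context: A distribution (for odd $t>1$) is an ordered tuple $\big(\frac{k_0(t-k_0)}{2},\frac{k_1(t-k_1)}{2},\frac{k_2(t-k_2)}{2},\frac{k_3(t-k_3)}{2}\big)$ of integers with $\frac{t-1}{2}\ge k_0\ge k_1\ge k_2\ge k_3\ge0$ satisfying $\sum_{i=0}^3\frac{k_i(t-k_i)}{2}=\frac{t(t-1)}{2}$. -}

module Defs where

open import Data.Nat using (ℕ; suc; _+_; _*_; _∸_; _≤_)
open import Data.Nat.DivMod using (_/_)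
open import Data.Product using (Σ; ∃; _×_; _,_)
open import Data.List using (List; length)
open import Data.List.Membership.Propositional using (_∈_)
open import Data.List.Relation.Unary.Unique.Propositional using (Unique)
open import Function.Bundles using (_⇔_)
open import Relation.Binary.PropositionalEquality using (_≡_)

Quad : Set
Quad = ℕ × ℕ × ℕ × ℕ

-- the entry k(t-k)/2 of a distribution (an exact division for odd t)
entry : ℕ → ℕ → ℕ
entry t k = (k * (t ∸ k)) / 2

IsDistribution : ℕ → Quad → Set
IsDistribution t (a₀ , a₁ , a₂ , a₃) =
  Σ ℕ λ k₀ → Σ ℕ λ k₁ → Σ ℕ λ k₂ → Σ ℕ λ k₃ →
    (k₀ ≤ (t ∸ 1) / 2) × (k₁ ≤ k₀) × (k₂ ≤ k₁) × (k₃ ≤ k₂) ×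
    (a₀ ≡ entry t k₀) × (a₁ ≡ entry t k₁) × (a₂ ≡ entry t k₂) × (a₃ ≡ entry t k₃) ×
    (a₀ + a₁ + a₂ + a₃ ≡ (t * (t ∸ 1)) / 2)

IsTriangular : ℕ → Set
IsTriangular n = ∃ λ m → n ≡ (m * suc m) / 2

IsTriangularRep : ℕ → Quad → Set
IsTriangularRep t (T₀ , T₁ , T₂ , T₃) =
  IsTriangular T₀ × IsTriangular T₁ × IsTriangular T₂ × IsTriangular T₃ ×
  (T₀ ≤ T₁) × (T₁ ≤ T₂) × (T₂ ≤ T₃) ×
  ((t ∸ 1) / 2 ≡ T₀ + T₁ + T₂ + T₃)

HasCardinality : {A : Set} → (A → Set) → ℕ → Set
HasCardinality {A} P n =
  Σ (List A) λ L → Unique L × (∀ a → (a ∈ L) ⇔ P a) × (length L ≡ n)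

-- Write t = 2s + 1.  With T(m) = m(m+1)/2, an entry satisfies k(t-k)/2 + T(s-k) = T(s)
-- (from T(k+m) = T(k) + km + T(m)), so the entries of a distribution are T(s) - T(mᵢ)
-- with mᵢ = s - kᵢ, and since t(t-1)/2 = 4T(s) - s the sum condition becomes
-- T(m₀) + T(m₁) + T(m₂) + T(m₃) = s.  Both kinds of objects are therefore injective
-- images of the sorted index quadruples (m₀ ≤ m₁ ≤ m₂ ≤ m₃) with T(m₀) + … + T(m₃) = s.
module Submission where

open import Defs
open import Data.Nat using (ℕ; zero; suc; _+_; _*_; _∸_; _/_; _%_; _≤_; _<_; z≤n; s≤s; _≤?_; _≟_)
open import Data.Nat.Properties
open import Data.Nat.DivMod using (m*n/n≡m; m≡m%n+[m/n]*n)
open import Data.Nat.Tactic.RingSolver using (solve-∀)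
open import Data.Product using (∃; _×_; _,_; proj₂)
open import Data.Product.Properties using (,-injectiveˡ; ,-injectiveʳ)
open import Data.List using (List; []; _∷_; map; filter; upTo; cartesianProduct; length)
open import Data.List.Properties using (length-map)
open import Data.List.Membership.Propositional using (_∈_)
open import Data.List.Membership.Propositional.Properties
  using (∈-map⁺; ∈-map⁻; ∈-filter⁺; ∈-filter⁻; ∈-cartesianProduct⁺; ∈-upTo⁺)
open import Data.List.Relation.Unary.Any using (here; there)
import Data.List.Relation.Unary.All as All
import Data.List.Relation.Unary.All.Properties as All
open import Data.List.Relation.Unary.AllPairs using ([]; _∷_)
open import Data.List.Relation.Unary.Unique.Propositional using (Unique)
import Data.List.Relation.Unary.Unique.Propositional.Properties as Unique
open import Relation.Nullary.Decidable using (_×-dec_)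
open import Relation.Unary using (Decidable)
open import Relation.Binary.PropositionalEquality
  using (_≡_; refl; sym; trans; cong; subst; module ≡-Reasoning)
open import Function.Bundles using (_⇔_; mk⇔; Equivalence)

module _ {A : Set} where

  Unique-map⁺-on : ∀ {B : Set} (f : A → B) {xs : List A} →
    (∀ {x y} → x ∈ xs → y ∈ xs → f x ≡ f y → x ≡ y) →
    Unique xs → Unique (map f xs)
  Unique-map⁺-on f inj [] = []
  Unique-map⁺-on f inj (x∉xs ∷ xs!) =
    All.map⁺ (All.tabulate λ y∈ fx≡fy → All.lookup x∉xs y∈ (inj (here refl) (there y∈) fx≡fy))
    ∷ Unique-map⁺-on f (λ x∈ y∈ → inj (there x∈) (there y∈)) xs!

  filter-hasCardinality : ∀ {P : A → Set} (P? : Decidable P) {xs : List A} →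
    Unique xs → (∀ {a} → P a → a ∈ xs) → HasCardinality P (length (filter P? xs))
  filter-hasCardinality P? {xs} xs! complete =
    filter P? xs , Unique.filter⁺ P? xs! ,
    (λ a → mk⇔ (λ a∈ → proj₂ (∈-filter⁻ P? {xs = xs} a∈)) (λ pa → ∈-filter⁺ P? (complete pa) pa)) ,
    refl

  image-hasCardinality : ∀ {B : Set} {P : A → Set} {Q : B → Set} {n} (f : A → B) →
    (∀ {a a'} → P a → P a' → f a ≡ f a' → a ≡ a') →
    (∀ b → Q b ⇔ (∃ λ a → P a × f a ≡ b)) →
    HasCardinality P n → HasCardinality Q n
  image-hasCardinality {P = P} {Q} f inj image (L , L! , L⇔P , |L|≡n) =
    map f L , Unique-map⁺-on f (λ x∈ y∈ → inj (inL x∈) (inL y∈)) L! ,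
    (λ b → mk⇔ (to b) (from b)) , trans (length-map f L) |L|≡n
    where
    inL : ∀ {a} → a ∈ L → P a
    inL = Equivalence.to (L⇔P _)
    to : ∀ b → b ∈ map f L → Q b
    to b b∈ with a , a∈ , refl ← ∈-map⁻ f b∈ = Equivalence.from (image b) (a , inL a∈ , refl)
    from : ∀ b → Q b → b ∈ map f L
    from b qb with a , pa , refl ← Equivalence.to (image b) qb =
      ∈-map⁺ f (Equivalence.from (L⇔P a) pa)

tri : ℕ → ℕ
tri zero    = zero
tri (suc m) = suc m + tri m

tri*2 : ∀ m → tri m * 2 ≡ m * suc m
tri*2 zero    = refl
tri*2 (suc m) = begin
  (suc m + tri m) * 2   ≡⟨ *-distribʳ-+ 2 (suc m) (tri m) ⟩
  suc m * 2 + tri m * 2 ≡⟨ cong (suc m * 2 +_) (tri*2 m) ⟩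
  suc m * 2 + m * suc m ≡⟨ ring m ⟩
  suc m * suc (suc m)   ∎
  where
  open ≡-Reasoning
  ring : ∀ m → suc m * 2 + m * suc m ≡ suc m * suc (suc m)
  ring = solve-∀

m*[1+m]/2≡tri[m] : ∀ m → m * suc m / 2 ≡ tri m
m*[1+m]/2≡tri[m] m = trans (cong (_/ 2) (sym (tri*2 m))) (m*n/n≡m (tri m) 2)

tri-isTriangular : ∀ m → IsTriangular (tri m)
tri-isTriangular m = m , sym (m*[1+m]/2≡tri[m] m)

isTriangular⇒≡tri : ∀ {n} → IsTriangular n → ∃ λ m → n ≡ tri m
isTriangular⇒≡tri (m , n≡) = m , trans n≡ (m*[1+m]/2≡tri[m] m)

tri-+ : ∀ k m → tri (k + m) ≡ tri k + k * m + tri m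
tri-+ zero    m = refl
tri-+ (suc k) m = trans (cong (suc (k + m) +_) (tri-+ k m)) (ring k m (tri k) (tri m))
  where
  ring : ∀ k m a b → suc (k + m) + (a + k * m + b) ≡ suc k + a + suc k * m + b
  ring = solve-∀

m≤tri[m] : ∀ m → m ≤ tri m
m≤tri[m] zero    = z≤n
m≤tri[m] (suc m) = m≤m+n (suc m) (tri m)

tri-mono-≤ : ∀ {m n} → m ≤ n → tri m ≤ tri n
tri-mono-≤ z≤n       = z≤n
tri-mono-≤ (s≤s m≤n) = +-mono-≤ (s≤s m≤n) (tri-mono-≤ m≤n)

tri-mono-< : ∀ {m n} → m < n → tri m < tri n
tri-mono-< {m} (s≤s m≤n) = ≤-trans (s≤s (m≤n+m (tri m) m)) (tri-mono-≤ (s≤s m≤n))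

tri-cancel-≤ : ∀ {m n} → tri m ≤ tri n → m ≤ n
tri-cancel-≤ tm≤tn = ≮⇒≥ λ n<m → <⇒≱ (tri-mono-< n<m) tm≤tn

tri-injective : ∀ {m n} → tri m ≡ tri n → m ≡ n
tri-injective eq = ≤-antisym (tri-cancel-≤ (≤-reflexive eq)) (tri-cancel-≤ (≤-reflexive (sym eq)))

entry-+-tri : ∀ {k m s} → k + m ≡ s → entry (suc (s * 2)) k + tri m ≡ tri s
entry-+-tri {k} {m} refl = begin
  k * (suc ((k + m) * 2) ∸ k) / 2 + tri m ≡⟨ cong (λ x → k * (x ∸ k) / 2 + tri m) (ring₁ k m) ⟩
  k * (k + suc (k + m * 2) ∸ k) / 2 + tri m ≡⟨ cong (λ x → k * x / 2 + tri m) (m+n∸m≡n k _) ⟩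
  k * suc (k + m * 2) / 2 + tri m         ≡⟨ cong (λ x → x / 2 + tri m) product≡ ⟩
  (tri k + k * m) * 2 / 2 + tri m         ≡⟨ cong (_+ tri m) (m*n/n≡m (tri k + k * m) 2) ⟩
  tri k + k * m + tri m                   ≡⟨ tri-+ k m ⟨
  tri (k + m)                             ∎
  where
  open ≡-Reasoning
  ring₁ : ∀ k m → suc ((k + m) * 2) ≡ k + suc (k + m * 2)
  ring₁ = solve-∀
  product≡ : k * suc (k + m * 2) ≡ (tri k + k * m) * 2
  product≡ = begin
    k * suc (k + m * 2)        ≡⟨ ring₂ k m ⟩
    k * suc k + k * m * 2      ≡⟨ cong (_+ k * m * 2) (tri*2 k) ⟨
    tri k * 2 + k * m * 2      ≡⟨ *-distribʳ-+ 2 (tri k) (k * m) ⟨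
    (tri k + k * m) * 2        ∎
    where
    ring₂ : ∀ k m → k * suc (k + m * 2) ≡ k * suc k + k * m * 2
    ring₂ = solve-∀

tri*4≡[1+2s]*2s/2+s : ∀ s → tri s + tri s + tri s + tri s ≡ suc (s * 2) * (s * 2) / 2 + s
tri*4≡[1+2s]*2s/2+s s = begin
  tri s + tri s + tri s + tri s  ≡⟨ ring₁ (tri s) ⟩
  tri s * 2 * 2                  ≡⟨ cong (_* 2) (tri*2 s) ⟩
  s * suc s * 2                  ≡⟨ ring₂ s ⟩
  s * suc (s * 2) + s            ≡⟨ cong (_+ s) (m*n/n≡m (s * suc (s * 2)) 2) ⟨
  s * suc (s * 2) * 2 / 2 + s    ≡⟨ cong (λ x → x / 2 + s) (ring₃ s) ⟩
  suc (s * 2) * (s * 2) / 2 + s  ∎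
  where
  open ≡-Reasoning
  ring₁ : ∀ x → x + x + x + x ≡ x * 2 * 2
  ring₁ = solve-∀
  ring₂ : ∀ s → s * suc s * 2 ≡ s * suc (s * 2) + s
  ring₂ = solve-∀
  ring₃ : ∀ s → s * suc (s * 2) * 2 ≡ suc (s * 2) * (s * 2)
  ring₃ = solve-∀

map₄ : (ℕ → ℕ) → Quad → Quad
map₄ f (a , b , c , d) = f a , f b , f c , f d

sum₄ : Quad → ℕ
sum₄ (a , b , c , d) = a + b + c + d

All₄ : (ℕ → Set) → Quad → Set
All₄ P (a , b , c , d) = P a × P b × P c × P d

Sorted₄ : Quad → Set
Sorted₄ (a , b , c , d) = a ≤ b × b ≤ c × c ≤ d

map₄-cong : ∀ {P : ℕ → Set} {f g : ℕ → ℕ} → (∀ {m} → P m → f m ≡ g m) →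
  ∀ {q} → All₄ P q → map₄ f q ≡ map₄ g q
map₄-cong f≗g (pa , pb , pc , pd)
  rewrite f≗g pa | f≗g pb | f≗g pc | f≗g pd = refl

map₄-injectiveOn : ∀ {P : ℕ → Set} (f : ℕ → ℕ) → (∀ {m n} → P m → P n → f m ≡ f n → m ≡ n) →
  ∀ {q q'} → All₄ P q → All₄ P q' → map₄ f q ≡ map₄ f q' → q ≡ q'
map₄-injectiveOn f inj (pa , pb , pc , pd) (pa' , pb' , pc' , pd') eq
  with refl ← inj pa pa' (,-injectiveˡ eq)
     | refl ← inj pb pb' (,-injectiveˡ (,-injectiveʳ eq))
     | refl ← inj pc pc' (,-injectiveˡ (,-injectiveʳ (,-injectiveʳ eq)))
     | refl ← inj pd pd' (,-injectiveʳ (,-injectiveʳ (,-injectiveʳ eq)))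
  = refl

sum₄-map₄-+ : ∀ f g q → sum₄ (map₄ f q) + sum₄ (map₄ g q) ≡ sum₄ (map₄ (λ m → f m + g m) q)
sum₄-map₄-+ f g (a , b , c , d) = ring (f a) (f b) (f c) (f d) (g a) (g b) (g c) (g d)
  where
  ring : ∀ a b c d a' b' c' d' →
    a + b + c + d + (a' + b' + c' + d') ≡ a + a' + (b + b') + (c + c') + (d + d')
  ring = solve-∀

box : ℕ → List Quad
box n = cartesianProduct range (cartesianProduct range (cartesianProduct range range))
  where
  range = upTo (suc n)

box-unique : ∀ n → Unique (box n)
box-unique n =
  Unique.cartesianProduct⁺ range!
    (Unique.cartesianProduct⁺ range! (Unique.cartesianProduct⁺ range! range!))
  where
  range! = Unique.upTo⁺ (suc n)

∈-box⁺ : ∀ {n q} → All₄ (_≤ n) q → q ∈ box n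
∈-box⁺ (a≤n , b≤n , c≤n , d≤n) =
  ∈-cartesianProduct⁺ (∈-upTo⁺ (s≤s a≤n))
    (∈-cartesianProduct⁺ (∈-upTo⁺ (s≤s b≤n))
      (∈-cartesianProduct⁺ (∈-upTo⁺ (s≤s c≤n)) (∈-upTo⁺ (s≤s d≤n))))

IsTriIndexRep : ℕ → Quad → Set
IsTriIndexRep s q = Sorted₄ q × sum₄ (map₄ tri q) ≡ s

isTriIndexRep? : ∀ s → Decidable (IsTriIndexRep s)
isTriIndexRep? s (a , b , c , d) = (a ≤? b ×-dec b ≤? c ×-dec c ≤? d) ×-dec (_ ≟ s)

triIndexRep-bounded : ∀ {s q} → IsTriIndexRep s q → All₄ (_≤ s) q
triIndexRep-bounded {s} {a , b , c , d} ((a≤b , b≤c , c≤d) , Σ≡s) = a≤s , b≤s , c≤s , d≤s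
  where
  d≤s = ≤-trans (m≤tri[m] d) (subst (tri d ≤_) Σ≡s (m≤n+m (tri d) _))
  c≤s = ≤-trans c≤d d≤s
  b≤s = ≤-trans b≤c c≤s
  a≤s = ≤-trans a≤b b≤s

triIndexReps-hasCardinality : ∀ s →
  HasCardinality (IsTriIndexRep s) (length (filter (isTriIndexRep? s) (box s)))
triIndexReps-hasCardinality s =
  filter-hasCardinality (isTriIndexRep? s) (box-unique s) (λ rep → ∈-box⁺ (triIndexRep-bounded rep))

module _ (s : ℕ) where

  private
    t : ℕ
    t = suc (s * 2)

    [t∸1]/2≡s : (t ∸ 1) / 2 ≡ s
    [t∸1]/2≡s = m*n/n≡m s 2

  complementEntry : ℕ → ℕ
  complementEntry m = entry t (s ∸ m)

  complementEntry-+-tri : ∀ {m} → m ≤ s → complementEntry m + tri m ≡ tri s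
  complementEntry-+-tri {m} m≤s = entry-+-tri {s ∸ m} {m} (m∸n+n≡m m≤s)

  complementEntry-injectiveOn : ∀ {m n} → m ≤ s → n ≤ s → complementEntry m ≡ complementEntry n → m ≡ n
  complementEntry-injectiveOn {m} {n} m≤s n≤s eq = tri-injective (+-cancelˡ-≡ (complementEntry m) _ _
    (trans (complementEntry-+-tri m≤s) (trans (sym (complementEntry-+-tri n≤s)) (cong (_+ tri n) (sym eq)))))

  sum₄-complementEntry : ∀ {q} → All₄ (_≤ s) q →
    sum₄ (map₄ complementEntry q) + sum₄ (map₄ tri q) ≡ t * (t ∸ 1) / 2 + s
  sum₄-complementEntry {q} q≤s = begin
    sum₄ (map₄ complementEntry q) + sum₄ (map₄ tri q)  ≡⟨ sum₄-map₄-+ complementEntry tri q ⟩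
    sum₄ (map₄ (λ m → complementEntry m + tri m) q)   ≡⟨ cong sum₄ (map₄-cong (λ {m} → complementEntry-+-tri {m}) q≤s) ⟩
    sum₄ (map₄ (λ _ → tri s) q)                       ≡⟨ tri*4≡[1+2s]*2s/2+s s ⟩
    t * (t ∸ 1) / 2 + s                               ∎
    where open ≡-Reasoning

  sum₄-complementEntry⇔ : ∀ {q} → All₄ (_≤ s) q →
    (sum₄ (map₄ complementEntry q) ≡ t * (t ∸ 1) / 2) ⇔ (sum₄ (map₄ tri q) ≡ s)
  sum₄-complementEntry⇔ {q} q≤s = mk⇔
    (λ eq → +-cancelˡ-≡ (t * (t ∸ 1) / 2) _ _ (trans (cong (_+ Σtri) (sym eq)) total))
    (λ eq → +-cancelʳ-≡ s _ _ (trans (cong (Σentries +_) (sym eq)) total))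
    where
    Σentries = sum₄ (map₄ complementEntry q)
    Σtri = sum₄ (map₄ tri q)
    total : Σentries + Σtri ≡ t * (t ∸ 1) / 2 + s
    total = sum₄-complementEntry q≤s

  distribution⇒triIndexRep : ∀ {a} → IsDistribution t a →
    ∃ λ q → IsTriIndexRep s q × map₄ complementEntry q ≡ a
  distribution⇒triIndexRep
    (k₀ , k₁ , k₂ , k₃ , k₀≤[t∸1]/2 , k₁≤k₀ , k₂≤k₁ , k₃≤k₂ , refl , refl , refl , refl , Σ≡) =
    q , ((∸-monoʳ-≤ s k₁≤k₀ , ∸-monoʳ-≤ s k₂≤k₁ , ∸-monoʳ-≤ s k₃≤k₂) , Σtri≡s) , entries≡
    where
    k = (k₀ , k₁ , k₂ , k₃)
    q = map₄ (s ∸_) k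
    k≤s : All₄ (_≤ s) k
    k≤s = let k₀≤s = subst (k₀ ≤_) [t∸1]/2≡s k₀≤[t∸1]/2 ; k₁≤s = ≤-trans k₁≤k₀ k₀≤s
              k₂≤s = ≤-trans k₂≤k₁ k₁≤s in
          k₀≤s , k₁≤s , k₂≤s , ≤-trans k₃≤k₂ k₂≤s
    entries≡ : map₄ complementEntry q ≡ map₄ (entry t) k
    entries≡ = map₄-cong {P = _≤ s} (λ {kᵢ} kᵢ≤s → cong (entry t) (m∸[m∸n]≡n {s} {kᵢ} kᵢ≤s)) k≤s
    Σtri≡s : sum₄ (map₄ tri q) ≡ s
    Σtri≡s = Equivalence.to (sum₄-complementEntry⇔ (m∸n≤m s k₀ , m∸n≤m s k₁ , m∸n≤m s k₂ , m∸n≤m s k₃))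
      (trans (cong sum₄ entries≡) Σ≡)

  triIndexRep⇒distribution : ∀ {q} → IsTriIndexRep s q → IsDistribution t (map₄ complementEntry q)
  triIndexRep⇒distribution {m₀ , m₁ , m₂ , m₃} rep@((m₀≤m₁ , m₁≤m₂ , m₂≤m₃) , Σtri≡s) =
    s ∸ m₀ , s ∸ m₁ , s ∸ m₂ , s ∸ m₃ ,
    subst (s ∸ m₀ ≤_) (sym [t∸1]/2≡s) (m∸n≤m s m₀) ,
    ∸-monoʳ-≤ s m₀≤m₁ , ∸-monoʳ-≤ s m₁≤m₂ , ∸-monoʳ-≤ s m₂≤m₃ ,
    refl , refl , refl , refl ,
    Equivalence.from (sum₄-complementEntry⇔ (triIndexRep-bounded rep)) Σtri≡s

  triangularRep⇒triIndexRep : ∀ {T} → IsTriangularRep t T → ∃ λ q → IsTriIndexRep s q × map₄ tri q ≡ T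
  triangularRep⇒triIndexRep (T₀△ , T₁△ , T₂△ , T₃△ , T₀≤T₁ , T₁≤T₂ , T₂≤T₃ , [t∸1]/2≡Σ)
    with m₀ , refl ← isTriangular⇒≡tri T₀△
       | m₁ , refl ← isTriangular⇒≡tri T₁△
       | m₂ , refl ← isTriangular⇒≡tri T₂△
       | m₃ , refl ← isTriangular⇒≡tri T₃△ =
    (m₀ , m₁ , m₂ , m₃) ,
    ((tri-cancel-≤ T₀≤T₁ , tri-cancel-≤ T₁≤T₂ , tri-cancel-≤ T₂≤T₃) , trans (sym [t∸1]/2≡Σ) [t∸1]/2≡s) ,
    refl

  triIndexRep⇒triangularRep : ∀ {q} → IsTriIndexRep s q → IsTriangularRep t (map₄ tri q)
  triIndexRep⇒triangularRep {m₀ , m₁ , m₂ , m₃} ((m₀≤m₁ , m₁≤m₂ , m₂≤m₃) , Σtri≡s) =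
    tri-isTriangular m₀ , tri-isTriangular m₁ , tri-isTriangular m₂ , tri-isTriangular m₃ ,
    tri-mono-≤ m₀≤m₁ , tri-mono-≤ m₁≤m₂ , tri-mono-≤ m₂≤m₃ ,
    trans [t∸1]/2≡s (sym Σtri≡s)

  distributions-triangularReps-equinumerous : ∃ λ n →
    HasCardinality (IsDistribution (suc (s * 2))) n × HasCardinality (IsTriangularRep (suc (s * 2))) n
  distributions-triangularReps-equinumerous = _ ,
    image-hasCardinality (map₄ complementEntry)
      (λ rep rep' → map₄-injectiveOn complementEntry complementEntry-injectiveOn
                      (triIndexRep-bounded rep) (triIndexRep-bounded rep'))
      (λ a → mk⇔ distribution⇒triIndexRep λ { (_ , rep , refl) → triIndexRep⇒distribution rep })
      (triIndexReps-hasCardinality s) ,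
    image-hasCardinality (map₄ tri)
      (λ rep rep' → map₄-injectiveOn tri (λ _ _ → tri-injective)
                      (triIndexRep-bounded rep) (triIndexRep-bounded rep'))
      (λ T → mk⇔ triangularRep⇒triIndexRep λ { (_ , rep , refl) → triIndexRep⇒triangularRep rep })
      (triIndexReps-hasCardinality s)

proposition3 : (t : ℕ) → 1 < t → t % 2 ≡ 1 →
    ∃ λ n → HasCardinality (IsDistribution t) n × HasCardinality (IsTriangularRep t) n
proposition3 t _ t%2≡1 =
  subst (λ t → ∃ λ n → HasCardinality (IsDistribution t) n × HasCardinality (IsTriangularRep t) n)
    (sym t≡1+[t/2]*2) (distributions-triangularReps-equinumerous (t / 2))
  where
  t≡1+[t/2]*2 : t ≡ suc (t / 2 * 2)
  t≡1+[t/2]*2 = trans (m≡m%n+[m/n]*n t 2) (cong (_+ t / 2 * 2) t%2≡1)
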